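{- Let $n\ge 2$ and $\sigma,\tau\in\mathfrak{S}_n$ with $\tau\le\sigma$ in the right weak order. Then (1) $G(\tau)$ is an induced subgraph of $G(\sigma)$, and (2) $G(\tau)$ is an induced subgraph of $G(w_0)$, where $w_0=[n\ n-1\ \cdots\ 1]$ is the longest element of $\mathfrak{S}_n$. Here $G(\tau)$ is regarded as a subgraph via a map $t\mapsto tx$ appending a fixed word $x$ (obtained from a saturated chain $\tau\lessdot\tau_1\lessdot\cdots\lessdot\sigma$ by appending one letter at each cover).
   Context: $\mathfrak{S}_n$ is the symmetric group on $[n]$ with simple transpositions $s_i=(i\ i+1)$; $\ell(\sigma)$ is the number of inversions; $\mathcal{R}(\sigma)$ is the set of reduced words $i_1\cdots i_l$ ($l=\ell(\sigma)$, $\sigma=s_{i_1}\cdots s_{i_l}$). Right weak order: $\tau\lessdot\sigma$ iff $\sigma=\tau s_i$ with $\ell(\sigma)=\ell(\tau)+1$, and $\le$ is its reflexive-transitive closure. $G(\sigma)$ is the graph on $\mathcal{R}(\sigma)$ whose edges join words related by a single commutation move ($ab\to ba$ for adjacent letters with $|a-b|>1$) or a single braid move ($a(a+1)a\leftrightarrow(a+1)a(a+1)$ on adjacent letters). An induced subgraph $H$ of $G$ has $V(H)\subseteq V(G)$ and contains exactly those edges of $G$ with both endpoints in $V(H)$. -}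

module Defs where

open import Data.Nat using (ℕ; zero; suc; _≤_; _<_; _<?_)
open import Data.List using (List; []; _∷_; _++_; length; filter; applyUpTo; reverse; foldl)
open import Data.List.Relation.Unary.All using (All)
open import Data.List.Relation.Binary.Permutation.Propositional using (_↭_)
open import Data.Product using (_×_; Σ)
open import Data.Sum using (_⊎_)
open import Relation.Binary.PropositionalEquality using (_≡_)

-- Permutations of [n] = {1,…,n} in one-line notation [σ(1) σ(2) … σ(n)].
idPerm : ℕ → List ℕ
idPerm n = applyUpTo suc n

IsPerm : ℕ → List ℕ → Set
IsPerm n σ = σ ↭ idPerm n

w₀ : ℕ → List ℕ
w₀ n = reverse (idPerm n)

-- right multiplication by s_i = (i i+1): swaps positions i and i+1 (1-indexed)
swapAt : ℕ → List ℕ → List ℕ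
swapAt (suc zero) (a ∷ b ∷ xs) = b ∷ a ∷ xs
swapAt (suc (suc k)) (x ∷ xs) = x ∷ swapAt (suc k) xs
swapAt _ xs = xs

inv : List ℕ → ℕ
inv [] = 0
inv (x ∷ xs) = length (filter (_<? x) xs) + inv xs
  where open Data.Nat using (_+_)

ValidWord : ℕ → List ℕ → Set
ValidWord n w = All (λ i → 1 ≤ i × suc i ≤ n) w

-- s_{i1} ⋯ s_{il} = id · s_{i1} · ⋯ · s_{il}
eval : ℕ → List ℕ → List ℕ
eval n w = foldl (λ σ i → swapAt i σ) (idPerm n) w

Reduced : ℕ → List ℕ → List ℕ → Set
Reduced n σ w = ValidWord n w × eval n w ≡ σ × length w ≡ inv σ

CoverBy : ℕ → List ℕ → ℕ → List ℕ → Set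
CoverBy n τ i σ = (1 ≤ i × suc i ≤ n) × σ ≡ swapAt i τ × inv σ ≡ suc (inv τ)

-- ChainWord n τ x σ : x = i₁ ⋯ iₖ is obtained from a saturated chain
-- τ ⋖ τ s_{i₁} ⋖ τ s_{i₁} s_{i₂} ⋖ ⋯ ⋖ σ, appending one letter at each cover.
-- (Existence of such x is exactly τ ≤ σ in right weak order.)
data ChainWord (n : ℕ) : List ℕ → List ℕ → List ℕ → Set where
  done : ∀ {τ} → ChainWord n τ [] τ
  step : ∀ {τ τ₁ σ i x} → CoverBy n τ i τ₁ → ChainWord n τ₁ x σ → ChainWord n τ (i ∷ x) σ

_≤R[_]_ : List ℕ → ℕ → List ℕ → Set
τ ≤R[ n ] σ = Σ (List ℕ) (λ x → ChainWord n τ x σ)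

-- edges of G(σ): a single commutation move or a single braid move
data Move : List ℕ → List ℕ → Set where
  comm : ∀ u v a b → (suc (suc a) ≤ b ⊎ suc (suc b) ≤ a) →
         Move (u ++ a ∷ b ∷ v) (u ++ b ∷ a ∷ v)
  braid₁ : ∀ u v a → Move (u ++ a ∷ suc a ∷ a ∷ v) (u ++ suc a ∷ a ∷ suc a ∷ v)
  braid₂ : ∀ u v a → Move (u ++ suc a ∷ a ∷ suc a ∷ v) (u ++ a ∷ suc a ∷ a ∷ v)

record InducedVia (n : ℕ) (τ σ x : List ℕ) : Set where
  field
    maps      : ∀ t → Reduced n τ t → Reduced n σ (t ++ x)
    injective : ∀ t t' → Reduced n τ t → Reduced n τ t' → t ++ x ≡ t' ++ x → t ≡ t'
    edges     : ∀ t t' → Reduced n τ t → Reduced n τ t' →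
                (Move t t' → Move (t ++ x) (t' ++ x)) × (Move (t ++ x) (t' ++ x) → Move t t')

-- Appending the word x read off a saturated chain τ ⋖ ⋯ ⋖ σ maps 𝓡(τ) into 𝓡(σ),
-- since evaluation and length are additive along the chain. Moves on t lift to t x,
-- and conversely a move between t x and t′ x (|t| = |t′|) must act inside t: the last
-- letter a move rewrites really changes, so if it sat in the common suffix x the two
-- words would agree there. Part (2) is part (1) for σ = w₀, once every permutation lies
-- below w₀: a permutation without an ascent is decreasing, hence w₀, and each ascent
-- raises ℓ, which is bounded by n(n-1)/2.
module Submission where

open import Defs
open import Algebra.Properties.CommutativeSemigroup using (x∙yz≈y∙xz)
open import Data.Empty using (⊥-elim)
open import Data.List
  using (List; []; _∷_; _++_; [_]; length; filter; foldl; applyDownFrom)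
open import Data.List.Properties
  using ( ∷-injective; ∷-injectiveˡ; ∷-injectiveʳ; ++-assoc; ++-cancelʳ; length-++
        ; foldl-++; length-filter; filter-accept; filter-reject; reverse-applyUpTo
        ; length-applyUpTo)
open import Data.List.Relation.Binary.Permutation.Propositional
  using (_↭_; prep; swap; ↭-refl; ↭-sym; ↭-trans; ↭⇒↭ₛ)
open import Data.List.Relation.Binary.Permutation.Propositional.Properties
  using (↭-length; filter-↭; ↭-reverse)
open import Data.List.Relation.Binary.Pointwise using (Pointwise-≡⇒≡)
open import Data.List.Relation.Unary.All using ([]; _∷_)
open import Data.List.Relation.Unary.All.Properties using (++⁺)
open import Data.List.Relation.Unary.Linked using (Linked; []; [-]; _∷_)
import Data.List.Relation.Unary.Sorted.TotalOrder.Properties as Sorted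
open import Data.Nat using (ℕ; zero; suc; _+_; _≤_; _≥_; _<?_; z≤n; s≤s)
open import Data.Nat.Properties
open import Data.Product using (_×_; _,_; Σ; ∃)
open import Data.Sum using (_⊎_; inj₁; inj₂)
open import Relation.Binary.Properties.TotalOrder ≤-totalOrder using (≥-totalOrder)
open import Relation.Binary.PropositionalEquality
  using (_≡_; _≢_; ≢-sym; refl; sym; trans; cong; subst; subst₂; module ≡-Reasoning)
open import Relation.Nullary using (yes; no)

private
  variable
    n : ℕ
    τ σ x : List ℕ

infixl 5 _·_

_·_ : List ℕ → List ℕ → List ℕ
τ · x = foldl (λ σ i → swapAt i σ) τ x

chainWord-· : ChainWord n τ x σ → τ · x ≡ σ
chainWord-· done = refl
chainWord-· (step (_ , refl , _) chain) = chainWord-· chain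

chainWord-inv : ChainWord n τ x σ → inv τ + length x ≡ inv σ
chainWord-inv {τ = τ} done = +-identityʳ (inv τ)
chainWord-inv {τ = τ} (step {x = x} (_ , _ , cover) chain) = begin
  inv τ + suc (length x)  ≡⟨ +-suc (inv τ) (length x) ⟩
  suc (inv τ) + length x  ≡⟨ cong (_+ length x) cover ⟨
  _ + length x            ≡⟨ chainWord-inv chain ⟩
  _                       ∎
  where open ≡-Reasoning

chainWord-valid : ChainWord n τ x σ → ValidWord n x
chainWord-valid done = []
chainWord-valid (step (valid , _) chain) = valid ∷ chainWord-valid chain

reduced-++ : ChainWord n τ x σ → ∀ {t} → Reduced n τ t → Reduced n σ (t ++ x)
reduced-++ {n} {τ} {x} {σ} chain {t} (valid , evalt , lengtht) =
  ++⁺ valid (chainWord-valid chain) , eval-t++x , length-t++x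
  where
  open ≡-Reasoning
  eval-t++x : eval n (t ++ x) ≡ σ
  eval-t++x = begin
    idPerm n · (t ++ x)  ≡⟨ foldl-++ _ (idPerm n) t x ⟩
    eval n t · x         ≡⟨ cong (_· x) evalt ⟩
    τ · x                ≡⟨ chainWord-· chain ⟩
    σ                    ∎
  length-t++x : length (t ++ x) ≡ inv σ
  length-t++x = begin
    length (t ++ x)       ≡⟨ length-++ t ⟩
    length t + length x   ≡⟨ cong (_+ length x) lengtht ⟩
    inv τ + length x      ≡⟨ chainWord-inv chain ⟩
    inv σ                 ∎

module _ {a} {A : Set a} where

  ++-∷-positionwise : ∀ (M M′ : List A) {c c′ v v′} → length M ≡ length M′ →
                      M ++ c ∷ v ≡ M′ ++ c′ ∷ v′ → c ≡ c′
  ++-∷-positionwise []      []       _  eq = ∷-injectiveˡ eq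
  ++-∷-positionwise (_ ∷ M) (_ ∷ M′) ∣M∣ eq =
    ++-∷-positionwise M M′ (suc-injective ∣M∣) (∷-injectiveʳ eq)

  length-++-congˡ : ∀ (u : List A) {p p′} → length p ≡ length p′ → length (u ++ p) ≡ length (u ++ p′)
  length-++-congˡ []      ∣p∣ = ∣p∣
  length-++-congˡ (_ ∷ u) ∣p∣ = cong suc (length-++-congˡ u ∣p∣)

  split-at-difference : ∀ (M M′ : List A) {c c′ v} t t′ x →
    length M ≡ length M′ → length t ≡ length t′ → c ≢ c′ →
    M ++ c ∷ v ≡ t ++ x → M′ ++ c′ ∷ v ≡ t′ ++ x →
    ∃ λ w → t ≡ M ++ c ∷ w × t′ ≡ M′ ++ c′ ∷ w
  split-at-difference [] [] [] [] x _ _ c≢c′ eq eq′ =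
    ⊥-elim (c≢c′ (∷-injectiveˡ (trans eq (sym eq′))))
  split-at-difference [] [] (_ ∷ t) (_ ∷ t′) x _ _ _ eq eq′
    with refl , v≡tx ← ∷-injective eq | refl , v≡t′x ← ∷-injective eq′ =
    t , refl , cong (_ ∷_) (sym (++-cancelʳ x t t′ (trans (sym v≡tx) v≡t′x)))
  split-at-difference (_ ∷ M) (_ ∷ M′) [] [] x ∣M∣ _ c≢c′ eq eq′ =
    ⊥-elim (c≢c′ (++-∷-positionwise M M′ (suc-injective ∣M∣) (∷-injectiveʳ (trans eq (sym eq′)))))
  split-at-difference (_ ∷ M) (_ ∷ M′) (_ ∷ t) (_ ∷ t′) x ∣M∣ ∣t∣ c≢c′ eq eq′
    with refl , eqᵣ ← ∷-injective eq | refl , eq′ᵣ ← ∷-injective eq′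
    with w , refl , refl ← split-at-difference M M′ t t′ x
                              (suc-injective ∣M∣) (suc-injective ∣t∣) c≢c′ eqᵣ eq′ᵣ =
    w , refl , refl

Move-++ʳ : ∀ {t t′} x → Move t t′ → Move (t ++ x) (t′ ++ x)
Move-++ʳ x (comm u v a b far) =
  subst₂ Move (sym (++-assoc u _ x)) (sym (++-assoc u _ x)) (comm u (v ++ x) a b far)
Move-++ʳ x (braid₁ u v a) =
  subst₂ Move (sym (++-assoc u _ x)) (sym (++-assoc u _ x)) (braid₁ u (v ++ x) a)
Move-++ʳ x (braid₂ u v a) =
  subst₂ Move (sym (++-assoc u _ x)) (sym (++-assoc u _ x)) (braid₂ u (v ++ x) a)

-- A move rewrites the window p c after u to p′ c′; its last letters c, c′ always differ.
Move-window-cancelʳ : ∀ u p p′ {c c′} → length p ≡ length p′ → c ≢ c′ →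
  (∀ w → Move (u ++ p ++ c ∷ w) (u ++ p′ ++ c′ ∷ w)) →
  ∀ {v t t′ x} → length t ≡ length t′ →
  u ++ p ++ c ∷ v ≡ t ++ x → u ++ p′ ++ c′ ∷ v ≡ t′ ++ x → Move t t′
Move-window-cancelʳ u p p′ {c} {c′} ∣p∣ c≢c′ move {v} {t} {t′} {x} ∣t∣ eq eq′
  with w , refl , refl ← split-at-difference (u ++ p) (u ++ p′) t t′ x (length-++-congˡ u ∣p∣) ∣t∣ c≢c′
                           (trans (++-assoc u p (c ∷ v)) eq) (trans (++-assoc u p′ (c′ ∷ v)) eq′) =
  subst₂ Move (sym (++-assoc u p (c ∷ w))) (sym (++-assoc u p′ (c′ ∷ w))) (move w)

far⇒≢ : ∀ {a b} → suc (suc a) ≤ b ⊎ suc (suc b) ≤ a → b ≢ a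
far⇒≢ (inj₁ a+2≤b) = >⇒≢ (≤-trans (n≤1+n _) a+2≤b)
far⇒≢ (inj₂ b+2≤a) = <⇒≢ (≤-trans (n≤1+n _) b+2≤a)

Move-cancelʳ : ∀ {t t′} x → length t ≡ length t′ → Move (t ++ x) (t′ ++ x) → Move t t′
Move-cancelʳ {t} {t′} x ∣t∣ move = cancel move refl refl
  where
  cancel : ∀ {s s′} → Move s s′ → s ≡ t ++ x → s′ ≡ t′ ++ x → Move t t′
  cancel (comm u _ a b far) = Move-window-cancelʳ u [ a ] [ b ] refl (far⇒≢ far)
    (λ w → comm u w a b far) ∣t∣
  cancel (braid₁ u _ a) = Move-window-cancelʳ u (a ∷ [ suc a ]) (suc a ∷ [ a ]) refl
    (≢-sym 1+n≢n) (λ w → braid₁ u w a) ∣t∣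
  cancel (braid₂ u _ a) = Move-window-cancelʳ u (suc a ∷ [ a ]) (a ∷ [ suc a ]) refl
    1+n≢n (λ w → braid₂ u w a) ∣t∣

chainWord⇒inducedVia : ChainWord n τ x σ → InducedVia n τ σ x
chainWord⇒inducedVia {x = x} chain = record
  { maps      = λ t → reduced-++ chain
  ; injective = λ t t′ _ _ → ++-cancelʳ x t t′
  ; edges     = λ t t′ (_ , _ , ∣t∣) (_ , _ , ∣t′∣) →
      Move-++ʳ x , Move-cancelʳ x (trans ∣t∣ (sym ∣t′∣))
  }

swapAt-↭ : ∀ i l → swapAt i l ↭ l
swapAt-↭ zero          l            = ↭-refl
swapAt-↭ (suc zero)    []           = ↭-refl
swapAt-↭ (suc zero)    (a ∷ [])     = ↭-refl
swapAt-↭ (suc zero)    (a ∷ b ∷ l)  = swap b a ↭-refl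
swapAt-↭ (suc (suc i)) []           = ↭-refl
swapAt-↭ (suc (suc i)) (a ∷ l)      = prep a (swapAt-↭ (suc i) l)

swapAt-perm : ∀ i → IsPerm n τ → IsPerm n (swapAt i τ)
swapAt-perm {τ = τ} i p = ↭-trans (swapAt-↭ i τ) p

length-filter-swapAt : ∀ y i l →
  length (filter (_<? y) (swapAt i l)) ≡ length (filter (_<? y) l)
length-filter-swapAt y i l = ↭-length (filter-↭ (_<? y) (swapAt-↭ i l))

UpperCover : List ℕ → Set
UpperCover l = ∃ λ i → CoverBy (length l) l i (swapAt i l)

Descending : List ℕ → Set
Descending = Linked _≥_

upperCover-or-descending : ∀ l → UpperCover l ⊎ Descending l
upperCover-or-descending []      = inj₂ []
upperCover-or-descending (a ∷ []) = inj₂ [-]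
upperCover-or-descending (a ∷ b ∷ l) with a <? b | upperCover-or-descending (b ∷ l)
... | yes a<b | _ = inj₁ (1 , (s≤s z≤n , s≤s (s≤s z≤n)) , refl , inv-swap)
  where
  inv-swap : inv (b ∷ a ∷ l) ≡ suc (inv (a ∷ b ∷ l))
  inv-swap rewrite filter-accept (_<? b) {a} {l} a<b
                 | filter-reject (_<? a) {b} {l} (<-asym a<b)
    = cong suc (x∙yz≈y∙xz +-commutativeSemigroup
                  (length (filter (_<? b) l)) (length (filter (_<? a) l)) (inv l))
... | no a≮b | inj₂ desc = inj₂ (≮⇒≥ a≮b ∷ desc)
... | no a≮b | inj₁ (suc i , (_ , i+2≤) , refl , cover) =
  inj₁ (suc (suc i) , (s≤s z≤n , s≤s i+2≤) , refl , inv-swap)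
  where
  open ≡-Reasoning
  inv-swap : inv (a ∷ swapAt (suc i) (b ∷ l)) ≡ suc (inv (a ∷ b ∷ l))
  inv-swap = begin
    length (filter (_<? a) (swapAt (suc i) (b ∷ l))) + inv (swapAt (suc i) (b ∷ l))
      ≡⟨ cong (_+ _) (length-filter-swapAt a (suc i) (b ∷ l)) ⟩
    length (filter (_<? a) (b ∷ l)) + inv (swapAt (suc i) (b ∷ l))
      ≡⟨ cong (length (filter (_<? a) (b ∷ l)) +_) cover ⟩
    length (filter (_<? a) (b ∷ l)) + suc (inv (b ∷ l))
      ≡⟨ +-suc _ _ ⟩
    suc (inv (a ∷ b ∷ l))
      ∎

triangular : ℕ → ℕ
triangular zero    = zero
triangular (suc m) = m + triangular m

inv≤triangular : ∀ l → inv l ≤ triangular (length l)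
inv≤triangular []      = z≤n
inv≤triangular (a ∷ l) = +-mono-≤ (length-filter (_<? a) l) (inv≤triangular l)

length-perm : IsPerm n σ → length σ ≡ n
length-perm {n} p = trans (↭-length p) (length-applyUpTo suc n)

perm-inv≤triangular : IsPerm n σ → inv σ ≤ triangular n
perm-inv≤triangular {σ = σ} p = subst (λ m → inv σ ≤ triangular m) (length-perm p) (inv≤triangular σ)

applyDownFrom-descending : ∀ n → Descending (applyDownFrom suc n)
applyDownFrom-descending zero          = []
applyDownFrom-descending (suc zero)    = [-]
applyDownFrom-descending (suc (suc n)) = n≤1+n (suc n) ∷ applyDownFrom-descending (suc n)

descending-perm≡w₀ : IsPerm n σ → Descending σ → σ ≡ w₀ n
descending-perm≡w₀ {n} {σ} p desc =
  trans (Pointwise-≡⇒≡ (Sorted.↗↭↗⇒≋ ≥-totalOrder desc (applyDownFrom-descending n) (↭⇒↭ₛ p↭down)))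
        (sym (reverse-applyUpTo suc n))
  where
  p↭down : σ ↭ applyDownFrom suc n
  p↭down = ↭-trans p (subst (idPerm n ↭_) (reverse-applyUpTo suc n) (↭-sym (↭-reverse (idPerm n))))

-- k bounds the number of covers still possible above τ.
chainWord-to-w₀ : ∀ k → IsPerm n τ → triangular n ≤ inv τ + k → ∃ λ y → ChainWord n τ y (w₀ n)
chainWord-to-w₀ {n} {τ} k p bound with upperCover-or-descending τ
... | inj₂ desc = [] , subst (ChainWord n τ []) (descending-perm≡w₀ p desc) done
... | inj₁ (i , cover@(_ , _ , inv-swap)) with k
...   | zero = ⊥-elim (1+n≰n (begin
        suc (inv τ)            ≡⟨ inv-swap ⟨
        inv (swapAt i τ)       ≤⟨ perm-inv≤triangular (swapAt-perm i p) ⟩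
        triangular n           ≤⟨ bound ⟩
        inv τ + 0              ≡⟨ +-identityʳ (inv τ) ⟩
        inv τ                  ∎))
  where open ≤-Reasoning
...   | suc k′ with y , chain ← chainWord-to-w₀ k′ (swapAt-perm i p)
                   (subst (triangular n ≤_) (trans (+-suc (inv τ) k′) (cong (_+ k′) (sym inv-swap))) bound)
  = i ∷ y , step (subst (λ m → CoverBy m τ i (swapAt i τ)) (length-perm p) cover) chain

perm≤w₀ : IsPerm n τ → τ ≤R[ n ] w₀ n
perm≤w₀ {n} {τ} p = chainWord-to-w₀ (triangular n) p (m≤n+m (triangular n) (inv τ))

corollary4p3 : (n : ℕ) → 2 ≤ n → (σ τ : List ℕ) → IsPerm n σ → IsPerm n τ →
    τ ≤R[ n ] σ →
    Σ (List ℕ) (λ x → ChainWord n τ x σ × InducedVia n τ σ x)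
    × Σ (List ℕ) (λ y → ChainWord n τ y (w₀ n) × InducedVia n τ (w₀ n) y)
corollary4p3 n _ σ τ _ τ-perm (x , chain) with y , chain₀ ← perm≤w₀ τ-perm =
  (x , chain , chainWord⇒inducedVia chain) , (y , chain₀ , chainWord⇒inducedVia chain₀)
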